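{- Let $\pi=\oplus[\xi_1,\dots,\xi_r]$ with $r\ge2$ where every $\xi_i$ is an increasing oscillation, identify each $\xi_i$ with the corresponding set of points in the diagram of $\pi$, and let $p$ be a pin representation of $\pi$. Then there is an index $i$ such that $p$ begins by entirely reading two consecutive children $\xi_i$ and $\xi_{i+1}$ (the first $|\xi_i|+|\xi_{i+1}|$ points of $p$ form $\xi_i\cup\xi_{i+1}$), after which $p$ reads each of the other children $\xi_j$ in one piece. Moreover, the children $\xi_j$ with $j<i$ are read in the order $\xi_{i-1},\xi_{i-2},\dots,\xi_1$ and the children $\xi_j$ with $j>i+1$ are read in the order $\xi_{i+2},\xi_{i+3},\dots,\xi_r$.
   Context: $\oplus[\pi_1,\dots,\pi_r]$ is the permutation whose diagram consists of copies of the diagrams of $\pi_1,\dots,\pi_r$ placed in this order along an increasing diagonal. Let $\omega=3\,1\,5\,2\,7\,4\,9\,6\cdots(2k+1)\,(2k-2)\cdots$ be the infinite oscillating sequence. An increasing oscillation of size $n\ge4$ is a simple permutation (size $\ge4$, only trivial blocks) of size $n$ contained as a pattern in $\omega$; the increasing oscillations of size less than $4$ are $1$, $21$, $231$, $312$. A pin representation of a permutation is a sequence of points $(p_1,\dots,p_n)$, no two on a common horizontal or vertical line, order-isomorphic to its diagram (identified with it), such that each $p_i$ ($i\ge2$) lies outside the bounding box (smallest axis-parallel rectangle) of $\{p_1,\dots,p_{i-1}\}$ and either separates $p_{i-1}$ from $\{p_1,\dots,p_{i-2}\}$ (the horizontal or vertical line through $p_i$ has them on opposite sides) or does not separate $\{p_1,\dots,p_{i-1}\}$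 into two nonempty sets. A set $D$ of points is read in one piece by $p$ if its points form a single maximal factor (consecutive block) of $p$. -}

module Defs where

open import Data.Nat using (ℕ; zero; suc; _+_; _∸_; _≤_; _<_)
open import Data.Fin using (Fin; toℕ) renaming (zero to fzero; suc to fsuc)
open import Data.Product using (Σ; ∃; _×_; _,_)
open import Data.Sum using (_⊎_)
open import Data.Unit using (⊤)
open import Data.Empty using (⊥)
open import Relation.Binary.PropositionalEquality using (_≡_; _≢_)
open import Function.Definitions using (Injective)

-- A permutation of size n: an injective (hence bijective) map on Fin n.
-- Its diagram is the set of points (toℕ x , toℕ (fun x)).
record Perm (n : ℕ) : Set where
  field
    fun : Fin n → Fin n
    inj : Injective _≡_ _≡_ fun
open Perm public

-- The infinite oscillating sequence ω = 3 1 5 2 7 4 9 6 ... (0-indexed positions).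
ω : ℕ → ℕ
ω 0 = 3
ω 1 = 1
ω 2 = 5
ω 3 = 2
ω (suc (suc (suc (suc m)))) = 2 + ω (suc (suc m))

ContainedInω : ∀ {n} → Perm n → Set
ContainedInω {n} π =
  Σ (Fin n → ℕ) λ e →
    (∀ a b → toℕ a < toℕ b → e a < e b) ×
    (∀ a b → (toℕ (fun π a) < toℕ (fun π b) → ω (e a) < ω (e b)) ×
             (ω (e a) < ω (e b) → toℕ (fun π a) < toℕ (fun π b)))

IsBlock : ∀ {n} → Perm n → Fin n → Fin n → Set
IsBlock {n} π a b =
  ∀ (x y v : Fin n) →
    toℕ a ≤ toℕ x → toℕ x ≤ toℕ b → toℕ a ≤ toℕ y → toℕ y ≤ toℕ b →
    toℕ (fun π x) ≤ toℕ v → toℕ v ≤ toℕ (fun π y) →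
    Σ (Fin n) λ z → toℕ a ≤ toℕ z × toℕ z ≤ toℕ b × fun π z ≡ v

Simple : ∀ {n} → Perm n → Set
Simple {n} π =
  4 ≤ n ×
  (∀ (a b : Fin n) → toℕ a ≤ toℕ b → IsBlock π a b →
     (a ≡ b) ⊎ (toℕ a ≡ 0 × toℕ b ≡ n ∸ 1))

-- The increasing oscillations of size < 4: 1, 21, 231, 312 (values 0-indexed).
SmallIncOsc : ∀ {n} → Perm n → Set
SmallIncOsc {1} π = ⊤
SmallIncOsc {2} π = toℕ (fun π fzero) ≡ 1
SmallIncOsc {3} π =
  (toℕ (fun π fzero) ≡ 1 × toℕ (fun π (fsuc fzero)) ≡ 2 × toℕ (fun π (fsuc (fsuc fzero))) ≡ 0)
  ⊎ (toℕ (fun π fzero) ≡ 2 × toℕ (fun π (fsuc fzero)) ≡ 0 × toℕ (fun π (fsuc (fsuc fzero))) ≡ 1)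
SmallIncOsc {_} π = ⊥

IncreasingOscillation : ∀ {n} → Perm n → Set
IncreasingOscillation π = (Simple π × ContainedInω π) ⊎ SmallIncOsc π

total : ∀ {r} → (Fin r → ℕ) → ℕ
total {zero} s = 0
total {suc r} s = s fzero + total (λ i → s (fsuc i))

offset : ∀ {r} → (Fin r → ℕ) → Fin r → ℕ
offset s fzero = 0
offset s (fsuc i) = s fzero + offset (λ j → s (fsuc j)) i

IsDirectSum : ∀ {r} (s : Fin r → ℕ) → ((i : Fin r) → Perm (s i)) → Perm (total s) → Set
IsDirectSum s ξ π =
  ∀ (x : Fin (total s)) (i : Fin _) (k : Fin (s i)) →
    toℕ x ≡ offset s i + toℕ k →
    toℕ (fun π x) ≡ offset s i + toℕ (fun (ξ i) k)

InChild : ∀ {r} (s : Fin r → ℕ) → Fin r → Fin (total s) → Set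
InChild s i x = offset s i ≤ toℕ x × toℕ x < offset s i + s i

-- A pin representation of π of size n, given as the reading order σ:
-- the k-th point p_k is the diagram point at position σ k.
module _ {n : ℕ} (π : Perm n) (σ : Fin n → Fin n) where
  X Y : Fin n → ℕ
  X k = toℕ (σ k)
  Y k = toℕ (fun π (σ k))

  OutsideBox : Fin n → Set
  OutsideBox k =
    (∀ j → toℕ j < toℕ k → X j < X k) ⊎ (∀ j → toℕ j < toℕ k → X k < X j) ⊎
    (∀ j → toℕ j < toℕ k → Y j < Y k) ⊎ (∀ j → toℕ j < toℕ k → Y k < Y j)

  Separates : Fin n → Set
  Separates k =
    Σ (Fin n) λ k₁ → suc (toℕ k₁) ≡ toℕ k ×
      (  (X k₁ < X k × (∀ j → toℕ j < toℕ k₁ → X k < X j))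
       ⊎ (X k < X k₁ × (∀ j → toℕ j < toℕ k₁ → X j < X k))
       ⊎ (Y k₁ < Y k × (∀ j → toℕ j < toℕ k₁ → Y k < Y j))
       ⊎ (Y k < Y k₁ × (∀ j → toℕ j < toℕ k₁ → Y j < Y k)))

  Independent : Fin n → Set
  Independent k =
    ((∀ j → toℕ j < toℕ k → X j < X k) ⊎ (∀ j → toℕ j < toℕ k → X k < X j)) ×
    ((∀ j → toℕ j < toℕ k → Y j < Y k) ⊎ (∀ j → toℕ j < toℕ k → Y k < Y j))

  IsPinRepresentation : Set
  IsPinRepresentation =
    Injective _≡_ _≡_ σ ×
    (∀ k → 1 ≤ toℕ k → OutsideBox k × (Separates k ⊎ Independent k))

  ReadInOnePiece : (Fin n → Set) → Set
  ReadInOnePiece D =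
    ∀ (k₁ k k₂ : Fin n) → toℕ k₁ ≤ toℕ k → toℕ k ≤ toℕ k₂ →
      D (σ k₁) → D (σ k₂) → D (σ k)

module Submission where

-- Increasing oscillations are ⊕-indecomposable. A pin leaves the bounding box of the earlier
-- points, so it never lies strictly between two earlier points in the dominance order, and once it
-- is south-west (north-east) of an earlier point it is south-west (north-east) of everything read
-- before its predecessor. Consequently no child can be left and re-entered after a point of
-- another child has been read: the part of it read afterwards would dominate, or be dominated by,
-- the part read before. The child of p₁ and the next child met are adjacent (a child between them
-- would be sandwiched), they are read completely before anything else, and every other child is
-- then read in one piece, moving away from this pair along the diagonal.

open import Defs
open import Data.Nat using (ℕ; zero; suc; _+_; _∸_; _≤_; _<_; z≤n; s≤s; _≤?_; _<?_; _≟_)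
open import Data.Nat.Properties
open import Data.Fin using (Fin; toℕ; fromℕ<; inject; punchIn; punchOut; splitAt; join)
  renaming (zero to fzero; suc to fsuc)
import Data.Fin.Properties as Fin
open import Data.Product using (Σ; ∃; _×_; _,_; proj₁; proj₂; map₁)
open import Data.Sum using (_⊎_; inj₁; inj₂; swap; [_,_]′)
import Data.Sum as Sum
open import Data.Empty using (⊥; ⊥-elim)
open import Function using (_∘_)
open import Function.Definitions using (Injective)
open import Relation.Nullary using (¬_; yes; no; contradiction; ¬?)
open import Relation.Nullary.Decidable using (decidable-stable; _⊎-dec_)
open import Relation.Unary using (Decidable)
open import Relation.Binary.PropositionalEquality
open import Relation.Binary.Definitions using (tri<; tri≈; tri>)

injective⇒surjective : ∀ {n} {f : Fin n → Fin n} → Injective _≡_ _≡_ f →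
                       ∀ y → ∃ λ x → f x ≡ y
injective⇒surjective {suc n} {f} f-inj y with Fin.any? (λ x → f x Fin.≟ y)
... | yes hit = hit
... | no miss = contradiction (Fin.injective⇒≤ punchOut∘f-injective) 1+n≰n
  where
  avoids : ∀ x → y ≢ f x
  avoids x y≡fx = miss (x , sym y≡fx)
  punchOut∘f-injective : Injective _≡_ _≡_ (λ x → punchOut (avoids x))
  punchOut∘f-injective eq = f-inj (Fin.punchOut-injective (avoids _) (avoids _) eq)

inject-fromℕ< : ∀ {n} {i j : Fin n} (j<i : toℕ j < toℕ i) → inject (fromℕ< j<i) ≡ j
inject-fromℕ< j<i = Fin.toℕ-injective (trans (Fin.toℕ-inject (fromℕ< j<i)) (Fin.toℕ-fromℕ< j<i))

minimal : ∀ {n} (P : Fin n → Set) → Decidable P → ∃ P →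
          ∃ λ x → P x × (∀ y → toℕ y < toℕ x → ¬ P y)
minimal P P? (x , px)
  with Fin.¬∀⟶∃¬-smallest _ (¬_ ∘ P) (¬? ∘ P?) (λ ∀¬P → ∀¬P x px)
... | m , ¬¬pm , below = m , decidable-stable (P? m) ¬¬pm , λ y y<m →
  subst (¬_ ∘ P) (inject-fromℕ< y<m) (below (fromℕ< y<m))

bounded-injection⇒≤ : ∀ {w n m} (g : Fin w → Fin n) → Injective _≡_ _≡_ g → (∀ l → toℕ (g l) < m) → w ≤ m
bounded-injection⇒≤ g g-inj g<m = Fin.injective⇒≤ {f = λ l → fromℕ< (g<m l)} λ eq →
  g-inj (Fin.toℕ-injective (trans (sym (Fin.toℕ-fromℕ< _)) (trans (cong toℕ eq) (Fin.toℕ-fromℕ< _))))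

another : ∀ {r} → 2 ≤ r → (a : Fin r) → ∃ λ b → b ≢ a
another {suc zero} (s≤s ()) _
another {suc (suc r)} _ a = punchIn a fzero , Fin.punchInᵢ≢i a fzero

module _ {n : ℕ} (ξ : Perm n) where

  IsSumCut : ℕ → Set
  IsSumCut p = 0 < p × p < n ×
    (∀ x y → toℕ x < p → p ≤ toℕ y → toℕ (fun ξ x) < toℕ (fun ξ y))

  SumIndecomposable : Set
  SumIndecomposable = ∀ p → ¬ IsSumCut p

  sumCut⇒prefixBlock : ∀ {p} → IsSumCut p → (a b : Fin n) →
                       toℕ a ≡ 0 → suc (toℕ b) ≡ p → IsBlock ξ a b
  sumCut⇒prefixBlock (_ , _ , cut) a b a≡0 b+1≡p x y v _ x≤b _ y≤b _ v≤ξy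
    with injective⇒surjective (inj ξ) v
  ... | z , ξz≡v = z , subst (_≤ toℕ z) (sym a≡0) z≤n , z≤b , ξz≡v
    where
    z≤b : toℕ z ≤ toℕ b
    z≤b with toℕ z ≤? toℕ b
    ... | yes z≤b = z≤b
    ... | no z≰b = contradiction v≤ξy (<⇒≱ (subst (λ w → toℕ (fun ξ y) < toℕ w) ξz≡v
            (cut y z (subst (toℕ y <_) b+1≡p (s≤s y≤b)) (subst (_≤ toℕ z) b+1≡p (≰⇒> z≰b)))))

  sumCut⇒suffixBlock : ∀ {p} → IsSumCut p → (a b : Fin n) →
                       toℕ a ≡ p → suc (toℕ b) ≡ n → IsBlock ξ a b
  sumCut⇒suffixBlock (_ , _ , cut) a b a≡p b+1≡n x y v a≤x _ _ _ ξx≤v _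
    with injective⇒surjective (inj ξ) v
  ... | z , ξz≡v = z , a≤z , ≤-pred (subst (toℕ z <_) (sym b+1≡n) (Fin.toℕ<n z)) , ξz≡v
    where
    a≤z : toℕ a ≤ toℕ z
    a≤z with toℕ a ≤? toℕ z
    ... | yes a≤z = a≤z
    ... | no a≰z = contradiction ξx≤v (<⇒≱ (subst (λ w → toℕ w < toℕ (fun ξ x)) ξz≡v
            (cut z x (subst (toℕ z <_) a≡p (≰⇒> a≰z)) (subst (_≤ toℕ x) a≡p a≤x))))

  sumCut⇒first<last : ∀ {p} → IsSumCut p → (x y : Fin n) →
                      toℕ x ≡ 0 → suc (toℕ y) ≡ n → toℕ (fun ξ x) < toℕ (fun ξ y)
  sumCut⇒first<last (0<p , p<n , cut) x y x≡0 y+1≡n =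
    cut x y (subst (_< _) (sym x≡0) 0<p) (≤-pred (subst (_ <_) (sym y+1≡n) p<n))

simple-blockBounds : ∀ {n} (ξ : Perm n) → Simple ξ → ∀ i j (i<n : i < n) (j<n : j < n) → i ≤ j →
                     IsBlock ξ (fromℕ< i<n) (fromℕ< j<n) → i ≡ j ⊎ (i ≡ 0 × j ≡ n ∸ 1)
simple-blockBounds ξ (_ , trivial) i j i<n j<n i≤j block
  with trivial _ _ (subst₂ _≤_ (sym (Fin.toℕ-fromℕ< i<n)) (sym (Fin.toℕ-fromℕ< j<n)) i≤j) block
... | inj₁ a≡b = inj₁ (trans (sym (Fin.toℕ-fromℕ< i<n)) (trans (cong toℕ a≡b) (Fin.toℕ-fromℕ< j<n)))
... | inj₂ (a≡0 , b≡n-1) =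
  inj₂ (trans (sym (Fin.toℕ-fromℕ< i<n)) a≡0 , trans (sym (Fin.toℕ-fromℕ< j<n)) b≡n-1)

-- The prefix block forces the cut after the first point, and then the suffix block forces n = 2.
simple⇒sumIndecomposable : ∀ {n} (ξ : Perm n) → Simple ξ → SumIndecomposable ξ
simple⇒sumIndecomposable {suc m} ξ simple@(4≤n , _) (suc p) cut@(_ , p<n , _)
  with simple-blockBounds ξ simple 0 p (s≤s z≤n) (<-trans (n<1+n p) p<n) z≤n
         (sumCut⇒prefixBlock ξ cut _ _ refl (cong suc (Fin.toℕ-fromℕ< (<-trans (n<1+n p) p<n))))
... | inj₂ (_ , refl) = <-irrefl refl p<n
... | inj₁ refl
  with simple-blockBounds ξ simple 1 m p<n (n<1+n m) (≤-pred (≤-trans (s≤s (s≤s z≤n)) 4≤n))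
         (sumCut⇒suffixBlock ξ cut _ _ (Fin.toℕ-fromℕ< p<n) (cong suc (Fin.toℕ-fromℕ< (n<1+n m))))
... | inj₁ refl = contradiction 4≤n λ { (s≤s (s≤s ())) }
... | inj₂ ()

-- Each of 21, 231, 312 starts above where it ends, which no sum α ⊕ β does.
small⇒sumIndecomposable : ∀ {n} (ξ : Perm n) → SmallIncOsc ξ → SumIndecomposable ξ
small⇒sumIndecomposable {1} ξ _ p (0<p , p<1 , _) = <-irrefl refl (<-≤-trans 0<p (≤-pred p<1))
small⇒sumIndecomposable {2} ξ ξ₀≡1 p cut =
  contradiction (Fin.toℕ<n (fun ξ (fsuc fzero)))
    (≤⇒≯ (subst (_< toℕ (fun ξ (fsuc fzero))) ξ₀≡1 (sumCut⇒first<last ξ cut fzero (fsuc fzero) refl refl)))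
small⇒sumIndecomposable {3} ξ (inj₁ (ξ₀≡1 , _ , ξ₂≡0)) p cut
  with subst₂ _<_ ξ₀≡1 ξ₂≡0 (sumCut⇒first<last ξ cut fzero (fsuc (fsuc fzero)) refl refl)
... | ()
small⇒sumIndecomposable {3} ξ (inj₂ (ξ₀≡2 , _ , ξ₂≡1)) p cut
  with subst₂ _<_ ξ₀≡2 ξ₂≡1 (sumCut⇒first<last ξ cut fzero (fsuc (fsuc fzero)) refl refl)
... | s≤s ()

incOsc⇒sumIndecomposable : ∀ {n} (ξ : Perm n) → IncreasingOscillation ξ → SumIndecomposable ξ
incOsc⇒sumIndecomposable ξ (inj₁ (simple , _)) = simple⇒sumIndecomposable ξ simple
incOsc⇒sumIndecomposable ξ (inj₂ small)        = small⇒sumIndecomposable ξ small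

incOsc⇒nonEmpty : ∀ {n} (ξ : Perm n) → IncreasingOscillation ξ → 0 < n
incOsc⇒nonEmpty {suc _} _ _            = s≤s z≤n
incOsc⇒nonEmpty {zero}  _ (inj₁ ((() , _) , _))

sumIndecomposable⇒noDominatedPart :
  ∀ {n} (ξ : Perm n) → SumIndecomposable ξ →
  (Q : Fin n → Set) → Decidable Q → ∃ Q → ∃ (¬_ ∘ Q) →
  ¬ (∀ x y → Q x → ¬ Q y → toℕ x < toℕ y × toℕ (fun ξ x) < toℕ (fun ξ y))
sumIndecomposable⇒noDominatedPart ξ indec Q Q? (x , qx) ∃¬Q dominated
  with minimal (¬_ ∘ Q) (¬? ∘ Q?) ∃¬Q
... | p , ¬qp , p-least = indec (toℕ p) (0<p , Fin.toℕ<n p , cut)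
  where
  0<p : 0 < toℕ p
  0<p = ≤-<-trans z≤n (proj₁ (dominated x p qx ¬qp))
  cut : ∀ a b → toℕ a < toℕ p → toℕ p ≤ toℕ b → toℕ (fun ξ a) < toℕ (fun ξ b)
  cut a b a<p p≤b = proj₂ (dominated a b (decidable-stable (Q? a) (p-least a a<p)) ¬qb)
    where
    ¬qb : ¬ Q b
    ¬qb qb = <⇒≱ (proj₁ (dominated b p qb ¬qp)) p≤b

offset+size≤total : ∀ {r} (s : Fin r → ℕ) c → offset s c + s c ≤ total s
offset+size≤total s fzero    = m≤m+n (s fzero) _
offset+size≤total s (fsuc c) = begin
  s fzero + offset (s ∘ fsuc) c + s (fsuc c)   ≡⟨ +-assoc (s fzero) _ _ ⟩
  s fzero + (offset (s ∘ fsuc) c + s (fsuc c)) ≤⟨ +-monoʳ-≤ (s fzero) (offset+size≤total (s ∘ fsuc) c) ⟩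
  s fzero + total (s ∘ fsuc)                   ∎
  where open ≤-Reasoning

offset+size≤offset : ∀ {r} (s : Fin r → ℕ) {c d} → toℕ c < toℕ d → offset s c + s c ≤ offset s d
offset+size≤offset s {fzero}  {fsuc d} _         = m≤m+n (s fzero) _
offset+size≤offset s {fsuc c} {fsuc d} (s≤s c<d) = begin
  s fzero + offset (s ∘ fsuc) c + s (fsuc c)   ≡⟨ +-assoc (s fzero) _ _ ⟩
  s fzero + (offset (s ∘ fsuc) c + s (fsuc c)) ≤⟨ +-monoʳ-≤ (s fzero) (offset+size≤offset (s ∘ fsuc) c<d) ⟩
  s fzero + offset (s ∘ fsuc) d                ∎
  where open ≤-Reasoning

childContaining : ∀ {r} (s : Fin r → ℕ) x → x < total s →
                  Σ (Fin r) λ c → offset s c ≤ x × x < offset s c + s c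
childContaining {zero}  s x ()
childContaining {suc r} s x x<total with x <? s fzero
... | yes x<s₀ = fzero , z≤n , x<s₀
... | no x≮s₀ with y , refl ← m≤n⇒∃[o]m+o≡n (≮⇒≥ x≮s₀)
  with c , lower , upper ← childContaining (s ∘ fsuc) y (+-cancelˡ-< (s fzero) _ _ x<total)
  = fsuc c , +-monoʳ-≤ (s fzero) lower ,
    subst (s fzero + y <_) (sym (+-assoc (s fzero) _ _)) (+-monoʳ-< (s fzero) upper)

module DirectSum {r : ℕ} (s : Fin r → ℕ) where

  inChild-< : ∀ {c d x y} → toℕ c < toℕ d → InChild s c x → InChild s d y → toℕ x < toℕ y
  inChild-< c<d (_ , x<end) (y≥start , _) = <-≤-trans x<end (≤-trans (offset+size≤offset s c<d) y≥start)

  inChild-unique : ∀ {c d x} → InChild s c x → InChild s d x → c ≡ d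
  inChild-unique {c} {d} x∈c x∈d with <-cmp (toℕ c) (toℕ d)
  ... | tri< c<d _ _ = contradiction (inChild-< c<d x∈c x∈d) (<-irrefl refl)
  ... | tri≈ _ c≡d _ = Fin.toℕ-injective c≡d
  ... | tri> _ _ d<c = contradiction (inChild-< d<c x∈d x∈c) (<-irrefl refl)

  childOf : Fin (total s) → Fin r
  childOf x = proj₁ (childContaining s (toℕ x) (Fin.toℕ<n x))

  inChild-childOf : ∀ x → InChild s (childOf x) x
  inChild-childOf x = proj₂ (childContaining s (toℕ x) (Fin.toℕ<n x))

  position : (c : Fin r) → Fin (s c) → Fin (total s)
  position c l = fromℕ< (<-≤-trans (+-monoʳ-< (offset s c) (Fin.toℕ<n l)) (offset+size≤total s c))

  toℕ-position : ∀ c l → toℕ (position c l) ≡ offset s c + toℕ l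
  toℕ-position c l = Fin.toℕ-fromℕ< _

  inChild-position : ∀ c l → InChild s c (position c l)
  inChild-position c l rewrite toℕ-position c l = m≤m+n _ _ , +-monoʳ-< (offset s c) (Fin.toℕ<n l)

  position-surjective : ∀ {c x} → InChild s c x → ∃ λ l → position c l ≡ x
  position-surjective {c} {x} (start≤x , x<end) = fromℕ< l<size , Fin.toℕ-injective (begin
    toℕ (position c (fromℕ< l<size))  ≡⟨ toℕ-position c _ ⟩
    offset s c + toℕ (fromℕ< l<size)  ≡⟨ cong (offset s c +_) (Fin.toℕ-fromℕ< l<size) ⟩
    offset s c + (toℕ x ∸ offset s c) ≡⟨ m+[n∸m]≡n start≤x ⟩
    toℕ x                             ∎)
    where
    open ≡-Reasoning
    l<size : toℕ x ∸ offset s c < s c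
    l<size = +-cancelˡ-< (offset s c) _ _ (subst (_< offset s c + s c) (sym (m+[n∸m]≡n start≤x)) x<end)

  module _ (ξ : (c : Fin r) → Perm (s c)) (π : Perm (total s)) (π≡⊕ξ : IsDirectSum s ξ π) where

    toℕ-fun-position : ∀ c l → toℕ (fun π (position c l)) ≡ offset s c + toℕ (fun (ξ c) l)
    toℕ-fun-position c l = π≡⊕ξ (position c l) c l (toℕ-position c l)

    inChild-fun : ∀ {c x} → InChild s c x → InChild s c (fun π x)
    inChild-fun {c} x∈c with l , refl ← position-surjective x∈c rewrite toℕ-fun-position c l =
      m≤m+n _ _ , +-monoʳ-< (offset s c) (Fin.toℕ<n (fun (ξ c) l))

module PinRepresentation {n : ℕ} (π : Perm n) (σ : Fin n → Fin n) (pin : IsPinRepresentation π σ) where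

  Xσ Yσ : Fin n → ℕ
  Xσ = X π σ
  Yσ = Y π σ

  infix 4 _≺_
  _≺_ : Fin n → Fin n → Set
  j ≺ k = Xσ j < Xσ k × Yσ j < Yσ k

  pinRule : ∀ k → 0 < toℕ k → OutsideBox π σ k × (Separates π σ k ⊎ Independent π σ k)
  pinRule = proj₂ pin

  not-sandwiched : ∀ {j₁ j₂ k} → toℕ j₁ < toℕ k → toℕ j₂ < toℕ k → j₁ ≺ k → k ≺ j₂ → ⊥
  not-sandwiched {j₁} {j₂} {k} j₁<k j₂<k j₁≺k k≺j₂ with proj₁ (pinRule k (≤-<-trans z≤n j₁<k))
  ... | inj₁ right              = <-asym (right j₂ j₂<k) (proj₁ k≺j₂)
  ... | inj₂ (inj₁ left)        = <-asym (left j₁ j₁<k) (proj₁ j₁≺k)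
  ... | inj₂ (inj₂ (inj₁ up))   = <-asym (up j₂ j₂<k) (proj₂ k≺j₂)
  ... | inj₂ (inj₂ (inj₂ down)) = <-asym (down j₁ j₁<k) (proj₂ j₁≺k)

  separator<pin : ∀ {k₁ q : Fin n} → suc (toℕ k₁) ≡ toℕ q → toℕ k₁ < toℕ q
  separator<pin {k₁} k₁+1≡q = subst (toℕ k₁ <_) k₁+1≡q (n<1+n (toℕ k₁))

  before-separator : ∀ {j k₁ q : Fin n} → suc (toℕ k₁) ≡ toℕ q → suc (toℕ j) < toℕ q → toℕ j < toℕ k₁
  before-separator {j} k₁+1≡q j+1<q = ≤-pred (subst (suc (toℕ j) <_) (sym k₁+1≡q) j+1<q)

  LeftOfAll RightOfAll BelowAll AboveAll : Fin n → Set
  LeftOfAll  q = ∀ j → toℕ j < toℕ q → Xσ q < Xσ j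
  RightOfAll q = ∀ j → toℕ j < toℕ q → Xσ j < Xσ q
  BelowAll   q = ∀ j → toℕ j < toℕ q → Yσ q < Yσ j
  AboveAll   q = ∀ j → toℕ j < toℕ q → Yσ j < Yσ q

  pinRule-≺ : ∀ {u q} → toℕ u < toℕ q → q ≺ u →
              (LeftOfAll q ⊎ BelowAll q) × (Separates π σ q ⊎ Independent π σ q)
  pinRule-≺ {u} {q} u<q (qu-x , qu-y) = map₁ leftOrBelow (pinRule q (≤-<-trans z≤n u<q))
    where
    leftOrBelow : OutsideBox π σ q → LeftOfAll q ⊎ BelowAll q
    leftOrBelow (inj₁ right)              = contradiction (right u u<q) (<-asym qu-x)
    leftOrBelow (inj₂ (inj₁ left))        = inj₁ left
    leftOrBelow (inj₂ (inj₂ (inj₁ up)))   = contradiction (up u u<q) (<-asym qu-y)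
    leftOrBelow (inj₂ (inj₂ (inj₂ down))) = inj₂ down

  pinRule-≻ : ∀ {u q} → toℕ u < toℕ q → u ≺ q →
              (RightOfAll q ⊎ AboveAll q) × (Separates π σ q ⊎ Independent π σ q)
  pinRule-≻ {u} {q} u<q (uq-x , uq-y) = map₁ rightOrAbove (pinRule q (≤-<-trans z≤n u<q))
    where
    rightOrAbove : OutsideBox π σ q → RightOfAll q ⊎ AboveAll q
    rightOrAbove (inj₁ right)              = inj₁ right
    rightOrAbove (inj₂ (inj₁ left))        = contradiction (left u u<q) (<-asym uq-x)
    rightOrAbove (inj₂ (inj₂ (inj₁ up)))   = inj₂ up
    rightOrAbove (inj₂ (inj₂ (inj₂ down))) = contradiction (down u u<q) (<-asym uq-y)

  -- OutsideBox gives one coordinate against all earlier points; the other comes from independence,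
  -- or from separating p_{q-1}, which then holds against all points before p_{q-1}.
  ≺-propagates : ∀ {u q} → suc (toℕ u) < toℕ q → q ≺ u → ∀ a → suc (toℕ a) < toℕ q → q ≺ a
  ≺-propagates {u} u+1<q q≺u@(qu-x , qu-y) a a+1<q with pinRule-≺ (<⇒≤ u+1<q) q≺u
  ... | _ , inj₂ (inj₁ right , _)        = contradiction (right u (<⇒≤ u+1<q)) (<-asym qu-x)
  ... | _ , inj₂ (_ , inj₁ up)           = contradiction (up u (<⇒≤ u+1<q)) (<-asym qu-y)
  ... | _ , inj₂ (inj₂ left , inj₂ down) = left a (<⇒≤ a+1<q) , down a (<⇒≤ a+1<q)
  ... | inj₁ left , inj₁ (k₁ , k₁+1≡q , inj₁ (k₁-left , _)) =
    contradiction (left k₁ (separator<pin k₁+1≡q)) (<-asym k₁-left)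
  ... | inj₂ down , inj₁ (k₁ , k₁+1≡q , inj₁ (_ , left-of-rest)) =
    left-of-rest a (before-separator k₁+1≡q a+1<q) , down a (<⇒≤ a+1<q)
  ... | _ , inj₁ (k₁ , k₁+1≡q , inj₂ (inj₁ (_ , right-of-rest))) =
    contradiction (right-of-rest u (before-separator k₁+1≡q u+1<q)) (<-asym qu-x)
  ... | inj₁ left , inj₁ (k₁ , k₁+1≡q , inj₂ (inj₂ (inj₁ (_ , below-rest)))) =
    left a (<⇒≤ a+1<q) , below-rest a (before-separator k₁+1≡q a+1<q)
  ... | inj₂ down , inj₁ (k₁ , k₁+1≡q , inj₂ (inj₂ (inj₁ (k₁-below , _)))) =
    contradiction (down k₁ (separator<pin k₁+1≡q)) (<-asym k₁-below)
  ... | _ , inj₁ (k₁ , k₁+1≡q , inj₂ (inj₂ (inj₂ (_ , above-rest)))) =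
    contradiction (above-rest u (before-separator k₁+1≡q u+1<q)) (<-asym qu-y)

  ≻-propagates : ∀ {u q} → suc (toℕ u) < toℕ q → u ≺ q → ∀ a → suc (toℕ a) < toℕ q → a ≺ q
  ≻-propagates {u} u+1<q u≺q@(uq-x , uq-y) a a+1<q with pinRule-≻ (<⇒≤ u+1<q) u≺q
  ... | _ , inj₂ (inj₂ left , _)          = contradiction (left u (<⇒≤ u+1<q)) (<-asym uq-x)
  ... | _ , inj₂ (_ , inj₂ down)          = contradiction (down u (<⇒≤ u+1<q)) (<-asym uq-y)
  ... | _ , inj₂ (inj₁ right , inj₁ up)   = right a (<⇒≤ a+1<q) , up a (<⇒≤ a+1<q)
  ... | _ , inj₁ (k₁ , k₁+1≡q , inj₁ (_ , left-of-rest)) =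
    contradiction (left-of-rest u (before-separator k₁+1≡q u+1<q)) (<-asym uq-x)
  ... | inj₁ right , inj₁ (k₁ , k₁+1≡q , inj₂ (inj₁ (k₁-right , _))) =
    contradiction (right k₁ (separator<pin k₁+1≡q)) (<-asym k₁-right)
  ... | inj₂ up , inj₁ (k₁ , k₁+1≡q , inj₂ (inj₁ (_ , right-of-rest))) =
    right-of-rest a (before-separator k₁+1≡q a+1<q) , up a (<⇒≤ a+1<q)
  ... | _ , inj₁ (k₁ , k₁+1≡q , inj₂ (inj₂ (inj₁ (_ , below-rest)))) =
    contradiction (below-rest u (before-separator k₁+1≡q u+1<q)) (<-asym uq-y)
  ... | inj₁ right , inj₁ (k₁ , k₁+1≡q , inj₂ (inj₂ (inj₂ (_ , above-rest)))) =
    right a (<⇒≤ a+1<q) , above-rest a (before-separator k₁+1≡q a+1<q)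
  ... | inj₂ up , inj₁ (k₁ , k₁+1≡q , inj₂ (inj₂ (inj₂ (k₁-above , _)))) =
    contradiction (up k₁ (separator<pin k₁+1≡q)) (<-asym k₁-above)

module PinsOfOscillationSum {r : ℕ} (s : Fin r → ℕ) (ξ : (c : Fin r) → Perm (s c))
  (incOsc : ∀ c → IncreasingOscillation (ξ c)) (π : Perm (total s)) (π≡⊕ξ : IsDirectSum s ξ π)
  (σ : Fin (total s) → Fin (total s)) (pin : IsPinRepresentation π σ) where

  open DirectSum s
  open PinRepresentation π σ pin

  N : ℕ
  N = total s

  child : Fin N → Fin r
  child k = childOf (σ k)

  child≡⇒inChild : ∀ {c k} → child k ≡ c → InChild s c (σ k)
  child≡⇒inChild {k = k} refl = inChild-childOf (σ k)

  inChild⇒child≡ : ∀ {c k} → InChild s c (σ k) → child k ≡ c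
  inChild⇒child≡ {k = k} = inChild-unique (inChild-childOf (σ k))

  distinct-children⇒distinct : ∀ {c d k k′} → child k ≡ c → child k′ ≡ d → c ≢ d → toℕ k ≢ toℕ k′
  distinct-children⇒distinct refl refl c≢d k≡k′ = c≢d (cong child (Fin.toℕ-injective k≡k′))

  child-<⇒≺ : ∀ {j k c d} → child j ≡ c → child k ≡ d → toℕ c < toℕ d → j ≺ k
  child-<⇒≺ {j} {k} refl refl lt =
    inChild-< lt (inChild-childOf (σ j)) (inChild-childOf (σ k)) ,
    inChild-< lt (inChild-fun ξ π π≡⊕ξ (inChild-childOf (σ j))) (inChild-fun ξ π π≡⊕ξ (inChild-childOf (σ k)))

  σ⁻¹ : Fin N → Fin N
  σ⁻¹ x = proj₁ (injective⇒surjective (proj₁ pin) x)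

  σ∘σ⁻¹ : ∀ x → σ (σ⁻¹ x) ≡ x
  σ∘σ⁻¹ x = proj₂ (injective⇒surjective (proj₁ pin) x)

  readingIndex : (c : Fin r) → Fin (s c) → Fin N
  readingIndex c l = σ⁻¹ (position c l)

  child-readingIndex : ∀ c l → child (readingIndex c l) ≡ c
  child-readingIndex c l = inChild⇒child≡ (subst (InChild s c) (sym (σ∘σ⁻¹ _)) (inChild-position c l))

  readingIndex-surjective : ∀ {c k} → child k ≡ c → ∃ λ l → readingIndex c l ≡ k
  readingIndex-surjective {k = k} k∈c with l , position≡σk ← position-surjective (child≡⇒inChild k∈c) =
    l , proj₁ pin (trans (σ∘σ⁻¹ _) position≡σk)

  readingIndex-injective : ∀ c → Injective _≡_ _≡_ (readingIndex c)
  readingIndex-injective c {l} {l′} eq = Fin.toℕ-injective (+-cancelˡ-≡ (offset s c) _ _ (begin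
    offset s c + toℕ l   ≡⟨ toℕ-position c l ⟨
    toℕ (position c l)   ≡⟨ cong toℕ (trans (sym (σ∘σ⁻¹ _)) (trans (cong σ eq) (σ∘σ⁻¹ _))) ⟩
    toℕ (position c l′)  ≡⟨ toℕ-position c l′ ⟩
    offset s c + toℕ l′  ∎))
    where open ≡-Reasoning

  readingIndex-≺ : ∀ c l l′ → readingIndex c l ≺ readingIndex c l′ →
                   toℕ l < toℕ l′ × toℕ (fun (ξ c) l) < toℕ (fun (ξ c) l′)
  readingIndex-≺ c l l′ (x< , y<) =
    +-cancelˡ-< (offset s c) _ _ (subst₂ _<_ (x-readingIndex l) (x-readingIndex l′) x<) ,
    +-cancelˡ-< (offset s c) _ _ (subst₂ _<_ (y-readingIndex l) (y-readingIndex l′) y<)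
    where
    x-readingIndex : ∀ l → Xσ (readingIndex c l) ≡ offset s c + toℕ l
    x-readingIndex l = trans (cong toℕ (σ∘σ⁻¹ _)) (toℕ-position c l)
    y-readingIndex : ∀ l → Yσ (readingIndex c l) ≡ offset s c + toℕ (fun (ξ c) l)
    y-readingIndex l = trans (cong (toℕ ∘ fun π) (σ∘σ⁻¹ _)) (toℕ-fun-position ξ π π≡⊕ξ c l)

  point : Fin r → Fin N
  point c = readingIndex c (fromℕ< (incOsc⇒nonEmpty (ξ c) (incOsc c)))

  child-point : ∀ c → child (point c) ≡ c
  child-point c = child-readingIndex c _

  child-noDominatedPart : ∀ c (Q : Fin N → Set) → Decidable Q →
    (∃ λ k → child k ≡ c × Q k) → (∃ λ k → child k ≡ c × ¬ Q k) →
    ¬ (∀ k k′ → child k ≡ c → child k′ ≡ c → Q k → ¬ Q k′ → k ≺ k′)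
  child-noDominatedPart c Q Q? (k , k∈c , qk) (k′ , k′∈c , ¬qk′) dominated =
    sumIndecomposable⇒noDominatedPart (ξ c) (incOsc⇒sumIndecomposable (ξ c) (incOsc c))
      (Q ∘ readingIndex c) (Q? ∘ readingIndex c) (local k∈c qk) (local k′∈c ¬qk′)
      λ l l′ ql ¬ql′ → readingIndex-≺ c l l′
        (dominated _ _ (child-readingIndex c l) (child-readingIndex c l′) ql ¬ql′)
    where
    local : ∀ {P : Fin N → Set} {k} → child k ≡ c → P k → ∃ (P ∘ readingIndex c)
    local {P} k∈c pk with l , refl ← readingIndex-surjective k∈c = l , pk

  Interrupted : Fin r → Fin N → Set
  Interrupted c m = child m ≢ c ×
    (∃ λ k → toℕ k < toℕ m × child k ≡ c) × (∃ λ k → toℕ m < toℕ k × child k ≡ c)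

  -- The points of c read after m lie south-west (north-east) of p_u, hence of every point read
  -- before m, so they split ξ_c as a direct sum.
  ¬interrupted-after-higher : ∀ {c d u m} → child u ≡ d → toℕ c < toℕ d → toℕ u < toℕ m → ¬ Interrupted c m
  ¬interrupted-after-higher {c} {d} {u} {m} u∈d c<d u<m (m∉c , (k₁ , k₁<m , k₁∈c) , (k₂ , m<k₂ , k₂∈c)) =
    child-noDominatedPart c (λ k → toℕ m < toℕ k) (λ k → toℕ m <? toℕ k)
      (k₂ , k₂∈c , m<k₂) (k₁ , k₁∈c , <⇒≯ k₁<m) later≺earlier
    where
    later≺earlier : ∀ q a → child q ≡ c → child a ≡ c → toℕ m < toℕ q → ¬ toℕ m < toℕ a → q ≺ a
    later≺earlier q a q∈c a∈c m<q m≮a = ≺-propagates (≤-trans (s≤s u<m) m<q)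
      (child-<⇒≺ q∈c u∈d c<d) a (≤-trans (s≤s a<m) m<q)
      where
      a<m : toℕ a < toℕ m
      a<m = ≤∧≢⇒< (≮⇒≥ m≮a) (distinct-children⇒distinct a∈c refl (m∉c ∘ sym))

  ¬interrupted-after-lower : ∀ {c d u m} → child u ≡ d → toℕ d < toℕ c → toℕ u < toℕ m → ¬ Interrupted c m
  ¬interrupted-after-lower {c} {d} {u} {m} u∈d d<c u<m (m∉c , (k₁ , k₁<m , k₁∈c) , (k₂ , m<k₂ , k₂∈c)) =
    child-noDominatedPart c (λ k → toℕ k < toℕ m) (λ k → toℕ k <? toℕ m)
      (k₁ , k₁∈c , k₁<m) (k₂ , k₂∈c , <⇒≯ m<k₂) earlier≺later
    where
    earlier≺later : ∀ a q → child a ≡ c → child q ≡ c → toℕ a < toℕ m → ¬ toℕ q < toℕ m → a ≺ q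
    earlier≺later a q a∈c q∈c a<m q≮m = ≻-propagates (≤-trans (s≤s u<m) m<q)
      (child-<⇒≺ u∈d q∈c d<c) a (≤-trans (s≤s a<m) m<q)
      where
      m<q : toℕ m < toℕ q
      m<q = ≤∧≢⇒< (≮⇒≥ q≮m) (distinct-children⇒distinct refl q∈c m∉c)

  skipped⇒interrupted : ∀ {j k₁ k k₂} → toℕ k₁ ≤ toℕ k → toℕ k ≤ toℕ k₂ →
                        child k₁ ≡ j → child k₂ ≡ j → child k ≢ j → Interrupted j k
  skipped⇒interrupted k₁≤k k≤k₂ k₁∈j k₂∈j k∉j =
    k∉j , (_ , ≤∧≢⇒< k₁≤k (distinct-children⇒distinct k₁∈j refl (k∉j ∘ sym)) , k₁∈j)
        , (_ , ≤∧≢⇒< k≤k₂ (distinct-children⇒distinct refl k₂∈j k∉j) , k₂∈j)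

  InPair : Fin r → Fin r → Fin N → Set
  InPair c d k = child k ≡ c ⊎ child k ≡ d

  ReadBy : Fin r → Fin N → Set
  ReadBy c t = ∃ λ k → toℕ k ≤ toℕ t × child k ≡ c

  module _ {c d : Fin r} {t : Fin N} (covered : ∀ k → toℕ k ≤ toℕ t → InPair c d k) where

    read-after-prefix : ∀ {q} → ¬ InPair c d q → toℕ t < toℕ q
    read-after-prefix {q} q∉cd = ≰⇒> (q∉cd ∘ covered q)

    -- A child strictly between c and d would be read after t, inside the box of a point of c and one of d.
    prefix-children-adjacent : ReadBy c t → ReadBy d t → toℕ c < toℕ d → toℕ d ≡ suc (toℕ c)
    prefix-children-adjacent (k , k≤t , k∈c) (k′ , k′≤t , k′∈d) c<d with toℕ d ≟ suc (toℕ c)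
    ... | yes adjacent = adjacent
    ... | no gap = ⊥-elim (not-sandwiched (≤-<-trans k≤t t<q) (≤-<-trans k′≤t t<q)
                     (child-<⇒≺ k∈c (child-point b) c<b) (child-<⇒≺ (child-point b) k′∈d b<d))
      where
      c+1<r : suc (toℕ c) < r
      c+1<r = ≤-<-trans c<d (Fin.toℕ<n d)
      b : Fin r
      b = fromℕ< c+1<r
      c<b : toℕ c < toℕ b
      c<b = subst (toℕ c <_) (sym (Fin.toℕ-fromℕ< c+1<r)) (n<1+n (toℕ c))
      b<d : toℕ b < toℕ d
      b<d = subst (_< toℕ d) (sym (Fin.toℕ-fromℕ< c+1<r)) (≤∧≢⇒< c<d (gap ∘ sym))
      t<q : toℕ t < toℕ (point b)
      t<q = read-after-prefix λ
        { (inj₁ q∈c) → <-irrefl (cong toℕ (trans (sym q∈c) (child-point b))) c<b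
        ; (inj₂ q∈d) → <-irrefl (cong toℕ (trans (sym (child-point b)) q∈d)) b<d }

  record OpeningPair : Set where
    field
      i i′     : Fin r
      adjacent : toℕ i′ ≡ suc (toℕ i)
      t        : Fin N
      covered  : ∀ k → toℕ k ≤ toℕ t → InPair i i′ k
      readᵢ    : ReadBy i t
      readᵢ′   : ReadBy i′ t

  orderedOpeningPair : ∀ {c d t} → (∀ k → toℕ k ≤ toℕ t → InPair c d k) →
                       ReadBy c t → ReadBy d t → c ≢ d → OpeningPair
  orderedOpeningPair {c} {d} {t} covered read-c read-d c≢d with <-cmp (toℕ c) (toℕ d)
  ... | tri< c<d _ _ = record
    { i = c ; i′ = d ; adjacent = prefix-children-adjacent covered read-c read-d c<d
    ; t = t ; covered = covered ; readᵢ = read-c ; readᵢ′ = read-d }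
  ... | tri≈ _ c≡d _ = ⊥-elim (c≢d (Fin.toℕ-injective c≡d))
  ... | tri> _ _ d<c = record
    { i = d ; i′ = c ; adjacent = prefix-children-adjacent (λ k → swap ∘ covered k) read-d read-c d<c
    ; t = t ; covered = λ k → swap ∘ covered k ; readᵢ = read-d ; readᵢ′ = read-c }

  openingPair-from : (first : Fin N) → toℕ first ≡ 0 → (∃ λ b → b ≢ child first) → OpeningPair
  openingPair-from first first≡0 (b , b≢c₀)
    with t , t∉c₀ , before-t ← minimal (λ k → child k ≢ child first) (λ k → ¬? (child k Fin.≟ child first))
                                      (point b , λ q∈c₀ → b≢c₀ (trans (sym (child-point b)) q∈c₀))
    = orderedOpeningPair covered (first , subst (_≤ toℕ t) (sym first≡0) z≤n , refl) (t , ≤-refl , refl) (t∉c₀ ∘ sym)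
    where
    covered : ∀ k → toℕ k ≤ toℕ t → InPair (child first) (child t) k
    covered k k≤t with m≤n⇒m<n∨m≡n k≤t
    ... | inj₁ k<t = inj₁ (decidable-stable (child k Fin.≟ child first) (before-t k k<t))
    ... | inj₂ k≡t = inj₂ (cong child (Fin.toℕ-injective k≡t))

  openingPair : 2 ≤ r → OpeningPair
  openingPair 2≤r = openingPair-from (fromℕ< N>0) (Fin.toℕ-fromℕ< N>0) (another 2≤r _)
    where
    N>0 : 0 < N
    N>0 = ≤-<-trans z≤n (Fin.toℕ<n (point (fromℕ< (≤-trans (s≤s z≤n) 2≤r))))

  module Pair (opening : OpeningPair) where
    open OpeningPair opening public

    i<i′ : toℕ i < toℕ i′
    i<i′ = subst (toℕ i <_) (sym adjacent) (n<1+n (toℕ i))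

    Outside : Fin r → Set
    Outside j = toℕ j < toℕ i ⊎ toℕ i′ < toℕ j

    outside-pair : ∀ {j} → j ≢ i → j ≢ i′ → Outside j
    outside-pair {j} j≢i j≢i′ with <-cmp (toℕ j) (toℕ i)
    ... | tri< j<i _ _ = inj₁ j<i
    ... | tri≈ _ j≡i _ = ⊥-elim (j≢i (Fin.toℕ-injective j≡i))
    ... | tri> _ _ i<j = inj₂ (≤∧≢⇒< (subst (_≤ toℕ j) (sym adjacent) i<j) (j≢i′ ∘ sym ∘ Fin.toℕ-injective))

    outside⇒∉pair : ∀ {j k} → Outside j → child k ≡ j → ¬ InPair i i′ k
    outside⇒∉pair (inj₁ j<i) refl (inj₁ refl) = <-irrefl refl j<i
    outside⇒∉pair (inj₁ j<i) refl (inj₂ refl) = <-irrefl refl (<-trans j<i i<i′)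
    outside⇒∉pair (inj₂ i′<j) refl (inj₁ refl) = <-irrefl refl (<-trans i<i′ i′<j)
    outside⇒∉pair (inj₂ i′<j) refl (inj₂ refl) = <-irrefl refl i′<j

    no-pair-after-outsider : ∀ {m q} → ¬ InPair i i′ m → InPair i i′ q → ¬ toℕ m < toℕ q
    no-pair-after-outsider {m} {q} m∉pair q∈pair m<q
      with readᵢ | readᵢ′ | outside-pair (m∉pair ∘ inj₁) (m∉pair ∘ inj₂) | q∈pair | read-after-prefix covered m∉pair
    ... | e , e≤t , e∈i | e′ , e′≤t , e′∈i′ | inj₁ m<i | inj₁ q∈i | t<m =
      not-sandwiched m<q (<-trans (≤-<-trans e′≤t t<m) m<q) (child-<⇒≺ refl q∈i m<i) (child-<⇒≺ q∈i e′∈i′ i<i′)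
    ... | e , e≤t , e∈i | e′ , e′≤t , e′∈i′ | inj₁ m<i | inj₂ q∈i′ | t<m =
      ¬interrupted-after-lower e∈i i<i′ (≤-<-trans e≤t t<m)
        (m∉pair ∘ inj₂ , (e′ , ≤-<-trans e′≤t t<m , e′∈i′) , (q , m<q , q∈i′))
    ... | e , e≤t , e∈i | e′ , e′≤t , e′∈i′ | inj₂ i′<m | inj₁ q∈i | t<m =
      ¬interrupted-after-higher e′∈i′ i<i′ (≤-<-trans e′≤t t<m)
        (m∉pair ∘ inj₁ , (e , ≤-<-trans e≤t t<m , e∈i) , (q , m<q , q∈i))
    ... | e , e≤t , e∈i | e′ , e′≤t , e′∈i′ | inj₂ i′<m | inj₂ q∈i′ | t<m =
      not-sandwiched (<-trans (≤-<-trans e≤t t<m) m<q) m<q (child-<⇒≺ e∈i q∈i′ i<i′) (child-<⇒≺ q∈i′ refl i′<m)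

    pair-before-outsider : ∀ {m q} → ¬ InPair i i′ m → InPair i i′ q → toℕ q < toℕ m
    pair-before-outsider {m} {q} m∉pair q∈pair = ≤∧≢⇒< (≮⇒≥ (no-pair-after-outsider m∉pair q∈pair))
      λ q≡m → m∉pair (subst (InPair i i′) (Fin.toℕ-injective q≡m) q∈pair)

    pairReadingIndex : Fin (s i) ⊎ Fin (s i′) → Fin N
    pairReadingIndex = [ readingIndex i , readingIndex i′ ]′

    inPair-pairReadingIndex : ∀ l → InPair i i′ (pairReadingIndex l)
    inPair-pairReadingIndex (inj₁ l) = inj₁ (child-readingIndex i l)
    inPair-pairReadingIndex (inj₂ l) = inj₂ (child-readingIndex i′ l)

    pairReadingIndex-injective : Injective _≡_ _≡_ pairReadingIndex
    pairReadingIndex-injective {inj₁ l} {inj₁ l′} eq = cong inj₁ (readingIndex-injective i eq)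
    pairReadingIndex-injective {inj₂ l} {inj₂ l′} eq = cong inj₂ (readingIndex-injective i′ eq)
    pairReadingIndex-injective {inj₁ l} {inj₂ l′} eq = ⊥-elim (<-irrefl (cong toℕ
      (trans (sym (child-readingIndex i l)) (trans (cong child eq) (child-readingIndex i′ l′)))) i<i′)
    pairReadingIndex-injective {inj₂ l} {inj₁ l′} eq = ⊥-elim (<-irrefl (cong toℕ
      (trans (sym (child-readingIndex i l′)) (trans (cong child (sym eq)) (child-readingIndex i′ l)))) i<i′)

    -- An outsider among the first |ξᵢ| + |ξᵢ′| reading indices would be preceded by all |ξᵢ| + |ξᵢ′|
    -- points of the pair.
    pair-read-first : ∀ k → toℕ k < s i + s i′ → InChild s i (σ k) ⊎ InChild s i′ (σ k)
    pair-read-first k k<size = Sum.map child≡⇒inChild child≡⇒inChild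
      (decidable-stable (child k Fin.≟ i ⊎-dec child k Fin.≟ i′) λ k∉pair →
        <⇒≱ k<size (bounded-injection⇒≤ (pairReadingIndex ∘ splitAt (s i))
          (splitAt-injective ∘ pairReadingIndex-injective)
          (λ l → pair-before-outsider k∉pair (inPair-pairReadingIndex (splitAt (s i) l)))))
      where
      splitAt-injective : Injective _≡_ _≡_ (splitAt (s i) {s i′})
      splitAt-injective {l} {l′} eq =
        trans (sym (Fin.join-splitAt (s i) _ l)) (trans (cong (join (s i) _) eq) (Fin.join-splitAt (s i) _ l′))

    read-after-pair : ∀ {j k} → Outside j → child k ≡ j → toℕ t < toℕ k
    read-after-pair j-outside k∈j = read-after-prefix covered (outside⇒∉pair j-outside k∈j)

    ¬interrupted-outside : ∀ {j u m} → Outside j → child u ≡ i → toℕ u < toℕ m → ¬ Interrupted j m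
    ¬interrupted-outside (inj₁ j<i)  u∈i = ¬interrupted-after-higher u∈i j<i
    ¬interrupted-outside (inj₂ i′<j) u∈i = ¬interrupted-after-lower u∈i (<-trans i<i′ i′<j)

    others-read-in-one-piece : ∀ j → j ≢ i → j ≢ i′ → ReadInOnePiece π σ (InChild s j)
    others-read-in-one-piece j j≢i j≢i′ k₁ k k₂ k₁≤k k≤k₂ k₁-in-j k₂-in-j with child k Fin.≟ j
    ... | yes k∈j = child≡⇒inChild k∈j
    ... | no k∉j with e , e≤t , e∈i ← readᵢ =
      ⊥-elim (¬interrupted-outside j-outside e∈i e<k (skipped⇒interrupted k₁≤k k≤k₂ k₁∈j k₂∈j k∉j))
      where
      j-outside : Outside j
      j-outside = outside-pair j≢i j≢i′
      k₁∈j : child k₁ ≡ j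
      k₁∈j = inChild⇒child≡ k₁-in-j
      k₂∈j : child k₂ ≡ j
      k₂∈j = inChild⇒child≡ k₂-in-j
      e<k : toℕ e < toℕ k
      e<k = ≤-<-trans e≤t (<-≤-trans (read-after-pair j-outside k₁∈j) k₁≤k)

    lower-children-descending : ∀ j j′ k k′ → toℕ j′ < toℕ j → toℕ j < toℕ i →
      InChild s j (σ k) → InChild s j′ (σ k′) → toℕ k < toℕ k′
    lower-children-descending j j′ k k′ j′<j j<i k-in-j k′-in-j′ with e , e≤t , e∈i ← readᵢ =
      ≤∧≢⇒< (≮⇒≥ k′≮k) (distinct-children⇒distinct k∈j k′∈j′ λ { refl → <-irrefl refl j′<j })
      where
      k∈j : child k ≡ j
      k∈j = inChild⇒child≡ k-in-j
      k′∈j′ : child k′ ≡ j′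
      k′∈j′ = inChild⇒child≡ k′-in-j′
      k′≮k : ¬ toℕ k′ < toℕ k
      k′≮k k′<k = not-sandwiched k′<k (≤-<-trans e≤t (read-after-pair (inj₁ j<i) k∈j))
        (child-<⇒≺ k′∈j′ k∈j j′<j) (child-<⇒≺ k∈j e∈i j<i)

    higher-children-ascending : ∀ j j′ k k′ → toℕ i′ < toℕ j → toℕ j < toℕ j′ →
      InChild s j (σ k) → InChild s j′ (σ k′) → toℕ k < toℕ k′
    higher-children-ascending j j′ k k′ i′<j j<j′ k-in-j k′-in-j′ with e′ , e′≤t , e′∈i′ ← readᵢ′ =
      ≤∧≢⇒< (≮⇒≥ k′≮k) (distinct-children⇒distinct k∈j k′∈j′ λ { refl → <-irrefl refl j<j′ })
      where
      k∈j : child k ≡ j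
      k∈j = inChild⇒child≡ k-in-j
      k′∈j′ : child k′ ≡ j′
      k′∈j′ = inChild⇒child≡ k′-in-j′
      k′≮k : ¬ toℕ k′ < toℕ k
      k′≮k k′<k = not-sandwiched (≤-<-trans e′≤t (read-after-pair (inj₂ i′<j) k∈j)) k′<k
        (child-<⇒≺ e′∈i′ k∈j i′<j) (child-<⇒≺ k∈j k′∈j′ j<j′)

mainTheorem12 :
    (r : ℕ) → 2 ≤ r →
    (s : Fin r → ℕ) (ξ : (i : Fin r) → Perm (s i)) →
    (∀ i → IncreasingOscillation (ξ i)) →
    (π : Perm (total s)) → IsDirectSum s ξ π →
    (σ : Fin (total s) → Fin (total s)) → IsPinRepresentation π σ →
    Σ (Fin r) λ i → Σ (Fin r) λ i′ → toℕ i′ ≡ suc (toℕ i) ×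
      (∀ k → toℕ k < s i + s i′ → InChild s i (σ k) ⊎ InChild s i′ (σ k)) ×
      (∀ j → j ≢ i → j ≢ i′ → ReadInOnePiece π σ (InChild s j)) ×
      (∀ j j′ k k′ → toℕ j′ < toℕ j → toℕ j < toℕ i →
         InChild s j (σ k) → InChild s j′ (σ k′) → toℕ k < toℕ k′) ×
      (∀ j j′ k k′ → toℕ i′ < toℕ j → toℕ j < toℕ j′ →
         InChild s j (σ k) → InChild s j′ (σ k′) → toℕ k < toℕ k′)
mainTheorem12 r 2≤r s ξ incOsc π π≡⊕ξ σ pin =
  i , i′ , adjacent , pair-read-first , others-read-in-one-piece ,
  lower-children-descending , higher-children-ascending
  where
  open PinsOfOscillationSum s ξ incOsc π π≡⊕ξ σ pin
  open Pair (openingPair 2≤r)
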